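{- Let $G$ be a finite simple graph of minimum degree at least $2$, and let $G^{+2}$ be the graph obtained from $G$ by subdividing each edge of $G$ into a path of length $3$ (i.e. replacing each edge $wz$ by a path $wxyz$ with two new vertices $x,y$). Then Sepy has a winning strategy in the Dom-start Disjoint Domination Game on $G^{+2}$.
   Context: For a vertex $v$, $N[v]$ denotes its closed neighborhood. The Disjoint Domination Game on an isolate-free graph $H=(V,E)$: Dom and Sepy alternately choose a previously uncolored vertex $v$ and color it purple or blue (either player may use either color). With $V_p,V_b$ the current color classes, coloring $v$ with $c$ is legal iff $v\notin V_p\cup V_b$ and some $u\in N[v]$ has $N[u]\cap V_c=\emptyset$. A player must make a legal move on his turn (no passing). The game terminates as soon as either (s) some vertex has its whole closed neighborhood colored with a single color (Sepy wins), or (d) both $V_p$ and $V_b$ are dominating sets of $H$ (Dom wins). In the Dom-start game Dom moves first. -}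

module Defs where

open import Data.Nat using (ℕ)
open import Data.Fin using (Fin)
open import Data.Bool using (Bool; true; false)
open import Data.Maybe using (Maybe; just; nothing)
open import Data.Product using (Σ; ∃; _×_; _,_; proj₁; proj₂)
open import Data.Sum using (_⊎_; inj₁; inj₂)
open import Data.Empty using (⊥)
open import Relation.Nullary using (¬_)
open import Relation.Binary.PropositionalEquality using (_≡_; _≢_)

record SimpleGraph (n : ℕ) : Set where
  field
    adj    : Fin n → Fin n → Bool
    irrefl : ∀ v → adj v v ≡ false
    sym    : ∀ u v → adj u v ≡ adj v u

Adj : ∀ {n} → SimpleGraph n → Fin n → Fin n → Set
Adj G u v = SimpleGraph.adj G u v ≡ true

MinDegree≥2 : ∀ {n} → SimpleGraph n → Set
MinDegree≥2 {n} G = ∀ (v : Fin n) → Σ (Fin n) λ u → Σ (Fin n) λ w →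
  u ≢ w × Adj G v u × Adj G v w

record Graph : Set₁ where
  field
    V : Set
    E : V → V → Set

-- New vertices are the ordered pairs (w , z) with w ~ z in G; the pair
-- (w , z) is the subdivision vertex on edge wz adjacent to w, and the
-- path for edge {w,z} is  w — (w,z) — (z,w) — z.

SubV : ∀ {n} → SimpleGraph n → Set
SubV {n} G = Fin n ⊎ Σ (Fin n × Fin n) (λ p → Adj G (proj₁ p) (proj₂ p))

SubE : ∀ {n} (G : SimpleGraph n) → SubV G → SubV G → Set
SubE G (inj₁ a) (inj₁ b) = ⊥
SubE G (inj₁ a) (inj₂ ((w , z) , _)) = a ≡ w
SubE G (inj₂ ((w , z) , _)) (inj₁ a) = w ≡ a
SubE G (inj₂ ((w , z) , _)) (inj₂ ((w' , z') , _)) = w' ≡ z × z' ≡ w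

Subdivide2 : ∀ {n} → SimpleGraph n → Graph
Subdivide2 G = record { V = SubV G ; E = SubE G }

data Color : Set where
  purple blue : Color

data Player : Set where
  dom sepy : Player

module Game (H : Graph) where
  open Graph H

  InN : V → V → Set
  InN v u = u ≡ v ⊎ E v u

  Coloring : Set
  Coloring = V → Maybe Color

  initial : Coloring
  initial _ = nothing

  Legal : Coloring → V → Color → Set
  Legal col v c = col v ≡ nothing ×
    Σ V (λ u → InN v u × (∀ w → InN u w → col w ≢ just c))

  Step : Coloring → V → Color → Coloring → Set
  Step col v c col' = col' v ≡ just c × (∀ u → u ≢ v → col' u ≡ col u)

  SepyWon : Coloring → Set
  SepyWon col = Σ V λ v → Σ Color λ c → ∀ u → InN v u → col u ≡ just c

  DomWon : Coloring → Set
  DomWon col = ∀ (c : Color) (v : V) → Σ V λ u → InN v u × col u ≡ just c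

  data SepyWins : Player → Coloring → Set where
    over      : ∀ {p col} → SepyWon col → SepyWins p col
    sepyMoves : ∀ {col} → ¬ SepyWon col → ¬ DomWon col →
                (v : V) (c : Color) (col' : Coloring) →
                Legal col v c → Step col v c col' →
                SepyWins dom col' → SepyWins sepy col
    domMoves  : ∀ {col} → ¬ SepyWon col → ¬ DomWon col →
                (∀ (v : V) (c : Color) (col' : Coloring) →
                   Legal col v c → Step col v c col' → SepyWins sepy col') →
                SepyWins dom col

SepyWinsDomStart : Graph → Set
SepyWinsDomStart H = Game.SepyWins H dom (Game.initial H)

-- Sepy's strategy: after Dom's first move Sepy colours an original vertex w and a subdivision
-- vertex x on an edge wz with the same colour c, so that colouring the vertex y on the same
-- edge next to z would make N[x] = {w, x, y} monochromatic. This threat is legal as long as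
-- N[z] contains no c, so Dom must answer inside N[z]. Sepy then colours the subdivision vertex
-- next to w on another edge wz' with c, which is legal because N[z'] is untouched, and the new
-- threat lives at z'. Closed neighbourhoods of distinct original vertices are disjoint, so Dom's
-- answers never disturb the threats still to come; once every edge at w is used, N[w] is
-- monochromatic. Minimum degree 2 provides Sepy's first reply when Dom opens on an edge.
module Submission where

open import Defs
open import Data.Nat using (ℕ; suc; _≥_)
open import Data.Fin using (Fin; zero) renaming (_≟_ to _≟F_)
open import Data.Fin.Properties using (any?; all?)
open import Data.Bool using (true)
open import Data.Bool.Properties using () renaming (_≟_ to _≟B_)
open import Data.Maybe using (just; nothing)
import Data.Maybe.Properties as Maybe
import Data.Product.Properties as Product
import Data.Sum.Properties as Sum
open import Data.Product using (Σ; ∃₂; _×_; _,_; proj₁; proj₂)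
open import Data.Sum using (_⊎_; inj₁; inj₂)
open import Data.Empty using (⊥; ⊥-elim)
open import Data.List using (List; []; _∷_; filter; allFin)
open import Data.List.Membership.Propositional using (_∈_)
open import Data.List.Membership.Propositional.Properties using (∈-filter⁺; ∈-filter⁻; ∈-allFin)
open import Data.List.Relation.Unary.Any using (here; there)
import Data.List.Relation.Unary.All as All
open import Data.List.Relation.Unary.AllPairs as AllPairs using (_∷_)
open import Data.List.Relation.Unary.Unique.Propositional using (Unique)
open import Data.List.Relation.Unary.Unique.Propositional.Properties using (allFin⁺; filter⁺)
open import Function using (_∘_)
open import Relation.Binary.Definitions using (DecidableEquality)
open import Relation.Unary using (Decidable)
open import Relation.Nullary using (¬_; Dec; yes; no)
open import Relation.Nullary.Decidable using (_×-dec_; _⊎-dec_; _→-dec_; map′; ¬?)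
open import Relation.Binary.PropositionalEquality
open import Axiom.UniquenessOfIdentityProofs using (module Decidable⇒UIP)

_≟C_ : DecidableEquality Color
purple ≟C purple = yes refl
purple ≟C blue   = no λ ()
blue   ≟C purple = no λ ()
blue   ≟C blue   = yes refl

any-color? : {P : Color → Set} → Decidable P → Dec (Σ Color P)
any-color? P? = map′ (λ { (inj₁ p) → purple , p ; (inj₂ p) → blue , p })
                     (λ { (purple , p) → inj₁ p ; (blue , p) → inj₂ p })
                     (P? purple ⊎-dec P? blue)

just≢nothing : ∀ {A : Set} {a : A} → just a ≢ nothing
just≢nothing ()

-- Whether Sepy has already won must be decidable: SepyWins only lets the game continue
-- from a position that is not yet won.
module Play (H : Graph) (_≟_ : DecidableEquality (Graph.V H))
            (sepyWon? : ∀ col → Dec (Game.SepyWon H col)) where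
  open Graph H
  open Game H

  Avoids : Coloring → V → Color → Set
  Avoids col u c = ∀ t → InN u t → col t ≢ just c

  Blank : Coloring → V → Set
  Blank col u = ∀ t → InN u t → col t ≡ nothing

  blank⇒avoids : ∀ {col u} → Blank col u → ∀ c → Avoids col u c
  blank⇒avoids blank c t t∈N[u] t-col = just≢nothing (trans (sym t-col) (blank t t∈N[u]))

  avoids⇒¬domWon : ∀ {col u c} → Avoids col u c → ¬ DomWon col
  avoids⇒¬domWon {u = u} {c = c} avoids domWon =
    let (t , t∈N[u] , t-col) = domWon c u in avoids t t∈N[u] t-col

  legal⇒¬domWon : ∀ {col v c} → Legal col v c → ¬ DomWon col
  legal⇒¬domWon (_ , _ , _ , avoids) = avoids⇒¬domWon avoids

  initial-¬domWon : V → ¬ DomWon initial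
  initial-¬domWon v domWon with domWon purple v
  ... | _ , _ , ()

  paint : Coloring → V → Color → Coloring
  paint col v c u with u ≟ v
  ... | yes _ = just c
  ... | no  _ = col u

  paint-step : ∀ col v c → Step col v c (paint col v c)
  paint-step col v c = hit , miss
    where
    hit : paint col v c v ≡ just c
    hit with v ≟ v
    ... | yes _   = refl
    ... | no  v≢v = ⊥-elim (v≢v refl)
    miss : ∀ u → u ≢ v → paint col v c u ≡ col u
    miss u u≢v with u ≟ v
    ... | yes u≡v = ⊥-elim (u≢v u≡v)
    ... | no  _   = refl

  module _ {col v c col'} (step : Step col v c col') where

    step-elsewhere : ∀ {u} → u ≢ v → col' u ≡ col u
    step-elsewhere = proj₂ step _

    step-keeps : col v ≡ nothing → ∀ {u d} → col u ≡ just d → col' u ≡ just d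
    step-keeps v-free u-col =
      trans (step-elsewhere λ { refl → just≢nothing (trans (sym u-col) v-free) }) u-col

    step-keeps-nothing : ∀ {u} → u ≢ v → col u ≡ nothing → col' u ≡ nothing
    step-keeps-nothing u≢v u-free = trans (step-elsewhere u≢v) u-free

    step-keeps-blank : ∀ {u} → ¬ InN u v → Blank col u → Blank col' u
    step-keeps-blank v∉N[u] blank t t∈N[u] =
      step-keeps-nothing (λ { refl → v∉N[u] t∈N[u] }) (blank t t∈N[u])

    step-keeps-avoids : ∀ {u d} → ¬ InN u v → Avoids col u d → Avoids col' u d
    step-keeps-avoids v∉N[u] avoids t t∈N[u] =
      avoids t t∈N[u] ∘ trans (sym (step-elsewhere λ { refl → v∉N[u] t∈N[u] }))

  after-two-moves : ∀ {m d col'} → Step initial m d col' → ∀ v c {t} → t ≢ m → t ≢ v →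
    paint col' v c t ≡ nothing
  after-two-moves step v c t≢m t≢v =
    trans (proj₂ (paint-step _ v c) _ t≢v) (step-elsewhere step t≢m)

  sepy-plays : ∀ {col v c} → Legal col v c → SepyWins dom (paint col v c) → SepyWins sepy col
  sepy-plays {col} legal next with sepyWon? col
  ... | yes won = over won
  ... | no ¬won = sepyMoves ¬won (legal⇒¬domWon legal) _ _ _ legal (paint-step _ _ _) next

  dom-to-move : ∀ {col} → ¬ DomWon col →
    (∀ v c col' → Legal col v c → Step col v c col' → SepyWins sepy col') → SepyWins dom col
  dom-to-move {col} ¬domWon replies with sepyWon? col
  ... | yes won = over won
  ... | no ¬won = domMoves ¬won ¬domWon replies

module Subdivided {n : ℕ} (G : SimpleGraph n) where
  open Game (Subdivide2 G)

  orig : Fin n → SubV G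
  orig = inj₁

  sub : (a b : Fin n) → Adj G a b → SubV G
  sub a b p = inj₂ ((a , b) , p)

  adjacent? : ∀ a b → Dec (Adj G a b)
  adjacent? a b = SimpleGraph.adj G a b ≟B true

  adj-sym : ∀ {a b} → Adj G a b → Adj G b a
  adj-sym {a} {b} p = trans (SimpleGraph.sym G b a) p

  adj⇒≢ : ∀ {a b} → Adj G a b → a ≢ b
  adj⇒≢ {a} p refl with trans (sym (SimpleGraph.irrefl G a)) p
  ... | ()

  sub-irrelevant : ∀ {a b} (p q : Adj G a b) → sub a b p ≡ sub a b q
  sub-irrelevant p q = cong (sub _ _) (Decidable⇒UIP.≡-irrelevant _≟B_ p q)

  _≟V_ : DecidableEquality (SubV G)
  _≟V_ = Sum.≡-dec _≟F_ (Product.≡-dec (Product.≡-dec _≟F_ _≟F_)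
                                        λ p q → yes (Decidable⇒UIP.≡-irrelevant _≟B_ p q))

  all-sub? : {P : SubV G → Set} → Decidable P → ∀ a b → Dec (∀ p → P (sub a b p))
  all-sub? {P} P? a b with adjacent? a b
  ... | yes p = map′ (λ Pp q → subst P (sub-irrelevant p q) Pp) (λ ∀P → ∀P p) (P? (sub a b p))
  ... | no ¬p = yes λ p → ⊥-elim (¬p p)

  any-sub? : {P : SubV G → Set} → Decidable P → ∀ a b → Dec (Σ (Adj G a b) (P ∘ sub a b))
  any-sub? {P} P? a b with adjacent? a b
  ... | yes p = map′ (p ,_) (λ (q , Pq) → subst P (sub-irrelevant q p) Pq) (P? (sub a b p))
  ... | no ¬p = no λ (p , _) → ¬p p

  all-vertices? : {P : SubV G → Set} → Decidable P → Dec (∀ v → P v)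
  all-vertices? P? =
    map′ (λ (P-orig , P-sub) → λ { (inj₁ a) → P-orig a ; (inj₂ ((a , b) , p)) → P-sub a b p })
         (λ ∀P → (λ a → ∀P (orig a)) , λ a b p → ∀P (sub a b p))
         (all? (P? ∘ orig) ×-dec all? λ a → all? λ b → all-sub? P? a b)

  any-vertex? : {P : SubV G → Set} → Decidable P → Dec (Σ (SubV G) P)
  any-vertex? P? =
    map′ (λ { (inj₁ (a , Pa)) → orig a , Pa ; (inj₂ (a , b , p , Pp)) → sub a b p , Pp })
         (λ { (inj₁ a , Pa) → inj₁ (a , Pa) ; (inj₂ ((a , b) , p) , Pp) → inj₂ (a , b , p , Pp) })
         (any? (P? ∘ orig) ⊎-dec any? λ a → any? λ b → any-sub? P? a b)

  subE? : ∀ u v → Dec (SubE G u v)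
  subE? (inj₁ _)               (inj₁ _)                 = no λ ()
  subE? (inj₁ a)               (inj₂ ((w , _) , _))     = a ≟F w
  subE? (inj₂ ((w , _) , _))   (inj₁ a)                 = w ≟F a
  subE? (inj₂ ((w , z) , _))   (inj₂ ((w' , z') , _))   = (w' ≟F z) ×-dec (z' ≟F w)

  inN? : ∀ v u → Dec (InN v u)
  inN? v u = (u ≟V v) ⊎-dec subE? v u

  sepyWon? : ∀ col → Dec (SepyWon col)
  sepyWon? col = any-vertex? λ v → any-color? λ c →
    all-vertices? λ t → inN? v t →-dec Maybe.≡-dec _≟C_ (col t) (just c)

  open Play (Subdivide2 G) _≟V_ sepyWon? public

  InN-orig : ∀ {a t} → InN (orig a) t → t ≡ orig a ⊎ ∃₂ λ b p → t ≡ sub a b p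
  InN-orig (inj₁ refl)                          = inj₁ refl
  InN-orig {t = inj₂ ((_ , b) , p)} (inj₂ refl) = inj₂ (b , p , refl)

  InN-sub : ∀ {a b p t} → InN (sub a b p) t →
    t ≡ sub a b p ⊎ t ≡ orig a ⊎ t ≡ sub b a (adj-sym p)
  InN-sub (inj₁ refl)                                   = inj₁ refl
  InN-sub {t = inj₁ _} (inj₂ refl)                      = inj₂ (inj₁ refl)
  InN-sub {p = p} {t = inj₂ (_ , q)} (inj₂ (refl , refl)) =
    inj₂ (inj₂ (sub-irrelevant q (adj-sym p)))

  InN-orig-orig : ∀ {z a} → InN (orig z) (orig a) → a ≡ z
  InN-orig-orig (inj₁ refl) = refl

  InN-orig-sub : ∀ {z a b p} → InN (orig z) (sub a b p) → z ≡ a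
  InN-orig-sub (inj₂ z≡a) = z≡a

  N[orig]-disjoint : ∀ {z z' t} → z ≢ z' → InN (orig z) t → InN (orig z') t → ⊥
  N[orig]-disjoint {t = inj₁ _} z≢z' t∈N[z] t∈N[z'] =
    z≢z' (trans (sym (InN-orig-orig t∈N[z])) (InN-orig-orig t∈N[z']))
  N[orig]-disjoint {t = inj₂ _} z≢z' t∈N[z] t∈N[z'] =
    z≢z' (trans (InN-orig-sub t∈N[z]) (sym (InN-orig-sub t∈N[z'])))

  orig∉N[orig] : ∀ {z a} → a ≢ z → ¬ InN (orig z) (orig a)
  orig∉N[orig] a≢z = a≢z ∘ InN-orig-orig

  sub∉N[orig] : ∀ {z a b p} → z ≢ a → ¬ InN (orig z) (sub a b p)
  sub∉N[orig] z≢a = z≢a ∘ InN-orig-sub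

  module Strategy (w : Fin n) (c : Color) where

    x : ∀ {z} → Adj G w z → SubV G
    x p = sub w _ p

    y : ∀ {z} → Adj G w z → SubV G
    y p = sub _ w (adj-sym p)

    Fresh : Coloring → Fin n → Set
    Fresh col z = Σ (Adj G w z) λ p → col (x p) ≡ nothing × Blank col (orig z)

    -- The threat is at z; L lists the neighbours of w still to be used as threats.
    record Siege (col : Coloring) (z : Fin n) (L : List (Fin n)) : Set where
      field
        w~z      : Adj G w z
        hub      : col (orig w) ≡ just c
        spoke    : col (x w~z) ≡ just c
        gap      : col (y w~z) ≡ nothing
        z-avoids : Avoids col (orig z) c
        covered  : ∀ {z'} (p : Adj G w z') → z' ∈ z ∷ L ⊎ col (x p) ≡ just c
        fresh    : ∀ {z'} → z' ∈ L → Fresh col z'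
        distinct : Unique (z ∷ L)

    siege-won : ∀ {col z} → Siege col z [] → SepyWon col
    siege-won {col} s = orig w , c , hub-monochromatic
      where
      open Siege s
      hub-monochromatic : ∀ t → InN (orig w) t → col t ≡ just c
      hub-monochromatic t t∈N[w] with InN-orig t∈N[w]
      ... | inj₁ refl = hub
      ... | inj₂ (_ , p , refl) with covered p
      ...   | inj₁ (here refl) = trans (cong col (sub-irrelevant p w~z)) spoke
      ...   | inj₂ x-col       = x-col

    strike : ∀ {col z L m d col'} → Siege col z L → col m ≡ nothing → Step col m d col' →
      ¬ InN (orig z) m → SepyWins sepy col'
    strike {col} {z} {col' = col'} s m-free step m∉N[z] = sepy-plays legal (over won)
      where
      open Siege s
      legal : Legal col' (y w~z) c
      legal = step-keeps-nothing step (λ { refl → m∉N[z] (inj₂ refl) }) gap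
            , orig z , inj₂ refl , step-keeps-avoids step m∉N[z] z-avoids
      keep : ∀ {t e} → col t ≡ just e → paint col' (y w~z) c t ≡ just e
      keep = step-keeps (paint-step col' (y w~z) c) (proj₁ legal) ∘ step-keeps step m-free
      won : SepyWon (paint col' (y w~z) c)
      won = x w~z , c , λ { t t∈N[x] → x-monochromatic t (InN-sub t∈N[x]) }
        where
        x-monochromatic : ∀ t → t ≡ x w~z ⊎ t ≡ orig w ⊎ t ≡ y w~z →
          paint col' (y w~z) c t ≡ just c
        x-monochromatic _ (inj₁ refl)         = keep spoke
        x-monochromatic _ (inj₂ (inj₁ refl))  = keep hub
        x-monochromatic _ (inj₂ (inj₂ refl))  = proj₁ (paint-step col' (y w~z) c)

    advance : ∀ {col z z' L m d col'} → Siege col z (z' ∷ L) → col m ≡ nothing →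
      Step col m d col' → InN (orig z) m →
      Σ (SubV G) λ v → Legal col' v c × Siege (paint col' v c) z' L
    advance {col} {z} {z'} {L} {m} {col' = col'} s m-free step m∈N[z] = x p' , legal , siege'
      where
      open Siege s
      p' : Adj G w z'
      p' = proj₁ (fresh (here refl))

      painted : Step col' (x p') c (paint col' (x p') c)
      painted = paint-step col' (x p') c

      z≢ : ∀ {z''} → z'' ∈ z' ∷ L → z ≢ z''
      z≢ = All.lookup (AllPairs.head distinct)

      m∉N : ∀ {z''} → z'' ∈ z' ∷ L → ¬ InN (orig z'') m
      m∉N mem = N[orig]-disjoint (z≢ mem) m∈N[z]

      x≢m : ∀ {z''} (p : Adj G w z'') → x p ≢ m
      x≢m _ refl = adj⇒≢ w~z (sym (InN-orig-sub m∈N[z]))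

      z'-blank : Blank col' (orig z')
      z'-blank = step-keeps-blank step (m∉N (here refl)) (proj₂ (proj₂ (fresh (here refl))))

      x'-free : col' (x p') ≡ nothing
      x'-free = step-keeps-nothing step (x≢m p') (proj₁ (proj₂ (fresh (here refl))))

      y'-blank : Blank col' (y p')
      y'-blank t t∈N[y'] with InN-sub t∈N[y']
      ... | inj₁ refl        = z'-blank _ (inj₂ refl)
      ... | inj₂ (inj₁ refl) = z'-blank _ (inj₁ refl)
      ... | inj₂ (inj₂ refl) = trans (cong col' (sub-irrelevant _ p')) x'-free

      legal : Legal col' (x p') c
      legal = x'-free , y p' , inj₂ (refl , refl) , blank⇒avoids y'-blank c

      keep : ∀ {t e} → col t ≡ just e → paint col' (x p') c t ≡ just e
      keep = step-keeps painted x'-free ∘ step-keeps step m-free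

      keep-blank : ∀ {z''} → Adj G w z'' → z'' ∈ z' ∷ L →
        Blank col (orig z'') → Blank (paint col' (x p') c) (orig z'')
      keep-blank p mem =
        step-keeps-blank painted (sub∉N[orig] (adj⇒≢ p ∘ sym))
        ∘ step-keeps-blank step (m∉N mem)

      z'-blank'' : Blank (paint col' (x p') c) (orig z')
      z'-blank'' = keep-blank p' (here refl) (proj₂ (proj₂ (fresh (here refl))))

      covered' : ∀ {z''} (p : Adj G w z'') → z'' ∈ z' ∷ L ⊎ paint col' (x p') c (x p) ≡ just c
      covered' p with covered p
      ... | inj₁ (here refl)  = inj₂ (keep (trans (cong col (sub-irrelevant p w~z)) spoke))
      ... | inj₁ (there mem)  = inj₁ mem
      ... | inj₂ x-col        = inj₂ (keep x-col)

      fresh' : ∀ {z''} → z'' ∈ L → Fresh (paint col' (x p') c) z''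
      fresh' mem with fresh (there mem)
      ... | p , x-free , blank =
        p , step-keeps-nothing painted x≢x' (step-keeps-nothing step (x≢m p) x-free)
          , keep-blank p (there mem) blank
        where
        x≢x' : x p ≢ x p'
        x≢x' refl = All.lookup (AllPairs.head (AllPairs.tail distinct)) mem refl

      siege' : Siege (paint col' (x p') c) z' L
      siege' = record
        { w~z      = p'
        ; hub      = keep hub
        ; spoke    = proj₁ painted
        ; gap      = z'-blank'' (y p') (inj₂ refl)
        ; z-avoids = blank⇒avoids z'-blank'' c
        ; covered  = covered'
        ; fresh    = fresh'
        ; distinct = AllPairs.tail distinct
        }

    siege-wins : ∀ {col z L} → Siege col z L → SepyWins dom col
    siege-wins {L = []}    s = over (siege-won s)
    siege-wins {col} {z} {L = _ ∷ _} s = dom-to-move (avoids⇒¬domWon (Siege.z-avoids s)) reply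
      where
      reply : ∀ m d col' → Legal col m d → Step col m d col' → SepyWins sepy col'
      reply m d col' (m-free , _) step with inN? (orig z) m
      ... | no  m∉N[z] = strike s m-free step m∉N[z]
      ... | yes m∈N[z] with advance s m-free step m∈N[z]
      ...   | _ , legal , s' = sepy-plays legal (siege-wins s')

    OtherNeighbour : Fin n → Fin n → Set
    OtherNeighbour z z' = Adj G w z' × z' ≢ z

    otherNeighbour? : ∀ z → Decidable (OtherNeighbour z)
    otherNeighbour? z z' = adjacent? w z' ×-dec ¬? (z' ≟F z)

    others : Fin n → List (Fin n)
    others z = filter (otherNeighbour? z) (allFin n)

    opening : ∀ {col z} (p : Adj G w z) → col (orig w) ≡ just c → col (x p) ≡ just c →
      (∀ t → t ≢ orig w → t ≢ x p → col t ≡ nothing) → Siege col z (others z)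
    opening {col} {z} p hub spoke rest = record
      { w~z      = p
      ; hub      = hub
      ; spoke    = spoke
      ; gap      = z-blank (y p) (inj₂ refl)
      ; z-avoids = blank⇒avoids z-blank c
      ; covered  = covered
      ; fresh    = fresh
      ; distinct = All.tabulate (λ mem → proj₂ (other mem) ∘ sym)
                 ∷ filter⁺ (otherNeighbour? z) (allFin⁺ n)
      }
      where
      far-from-w : ∀ {z'} → Adj G w z' → Blank col (orig z')
      far-from-w q t t∈N[z'] = rest t (λ { refl → orig∉N[orig] (adj⇒≢ q) t∈N[z'] })
                                      (λ { refl → sub∉N[orig] (adj⇒≢ q ∘ sym) t∈N[z'] })

      other : ∀ {z'} → z' ∈ others z → OtherNeighbour z z'
      other = proj₂ ∘ ∈-filter⁻ (otherNeighbour? z) {xs = allFin n}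

      z-blank : Blank col (orig z)
      z-blank = far-from-w p

      covered : ∀ {z'} (q : Adj G w z') → z' ∈ z ∷ others z ⊎ col (x q) ≡ just c
      covered {z'} q with z' ≟F z
      ... | yes refl  = inj₁ (here refl)
      ... | no  z'≢z = inj₁ (there (∈-filter⁺ (otherNeighbour? z) (∈-allFin z') (q , z'≢z)))

      fresh : ∀ {z'} → z' ∈ others z → Fresh col z'
      fresh mem with other mem
      ... | q , z'≢z = q , rest (x q) (λ ()) (λ { refl → z'≢z refl }) , far-from-w q

  open Strategy using (x; y; opening; siege-wins)

  another-neighbour : MinDegree≥2 G → ∀ w z → Σ (Fin n) λ z₂ → Adj G w z₂ × z₂ ≢ z
  another-neighbour δ≥2 w z with δ≥2 w
  ... | u₁ , u₂ , u₁≢u₂ , p₁ , p₂ with u₁ ≟F z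
  ...   | yes refl = u₂ , p₂ , u₁≢u₂ ∘ sym
  ...   | no u₁≢z  = u₁ , p₁ , u₁≢z

  first-reply : MinDegree≥2 G →
    ∀ m d col' → Legal initial m d → Step initial m d col' → SepyWins sepy col'
  first-reply δ≥2 (inj₁ w) d col' _ step with δ≥2 w
  ... | _ , _ , _ , p , _ =
    sepy-plays legal (siege-wins w d (opening w d p hub (proj₁ painted) rest))
    where
    painted : Step col' (x w d p) d (paint col' (x w d p) d)
    painted = paint-step col' (x w d p) d
    y-blank : Blank col' (y w d p)
    y-blank t t∈N[y] with InN-sub t∈N[y]
    ... | inj₁ refl        = step-elsewhere step λ ()
    ... | inj₂ (inj₁ refl) = step-elsewhere step λ { refl → adj⇒≢ p refl }
    ... | inj₂ (inj₂ refl) = step-elsewhere step λ ()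
    legal : Legal col' (x w d p) d
    legal = step-elsewhere step (λ ()) , y w d p , inj₂ (refl , refl) , blank⇒avoids y-blank d
    hub : paint col' (x w d p) d (orig w) ≡ just d
    hub = step-keeps painted (proj₁ legal) (proj₁ step)
    rest : ∀ t → t ≢ orig w → t ≢ x w d p → paint col' (x w d p) d t ≡ nothing
    rest t = after-two-moves step (x w d p) d
  first-reply δ≥2 (inj₂ ((w , z) , p)) d col' _ step with another-neighbour δ≥2 w z
  ... | _ , q , z₂≢z =
    sepy-plays legal (siege-wins w d (opening w d p (proj₁ painted) spoke rest))
    where
    painted : Step col' (orig w) d (paint col' (orig w) d)
    painted = paint-step col' (orig w) d
    x-blank : Blank col' (x w d q)
    x-blank t t∈N[x] with InN-sub t∈N[x]
    ... | inj₁ refl        = step-elsewhere step λ { refl → z₂≢z refl }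
    ... | inj₂ (inj₁ refl) = step-elsewhere step λ ()
    ... | inj₂ (inj₂ refl) = step-elsewhere step λ { refl → adj⇒≢ q refl }
    legal : Legal col' (orig w) d
    legal = step-elsewhere step (λ ()) , x w d q , inj₂ refl , blank⇒avoids x-blank d
    spoke : paint col' (orig w) d (x w d p) ≡ just d
    spoke = step-keeps painted (proj₁ legal) (proj₁ step)
    rest : ∀ t → t ≢ orig w → t ≢ x w d p → paint col' (orig w) d t ≡ nothing
    rest t t≢w t≢x = after-two-moves step (orig w) d t≢x t≢w

mainTheorem8 : (n : ℕ) → n ≥ 1 → (G : SimpleGraph n) → MinDegree≥2 G →
    SepyWinsDomStart (Subdivide2 G)
mainTheorem8 (suc _) _ G δ≥2 = dom-to-move (initial-¬domWon (orig zero)) (first-reply δ≥2)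
  where open Subdivided G
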